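{- Let $m,n\ge3$ and let $\mathcal{G}_T(m,n)=(V,E)$ be the $m\times n$ torus graph. Then for every subset $S\subset V$ with $2\le|S|\le|V|-2$, the set $C(S,S')$ of edges joining a vertex of $S$ to a vertex of $S'=V\setminus S$ has at least $6$ elements.
   Context: The $m\times n$ torus graph $\mathcal{G}_T(m,n)=(V,E)$ has vertex set $V=\{(i,j)\mid 0\le i\le m-1,\ 0\le j\le n-1\}$, and two distinct vertices $(i,j),(k,l)$ are adjacent if $|i-k|+|j-l|=1$, or if $j=l$ and $\{i,k\}=\{0,m-1\}$, or if $i=k$ and $\{j,l\}=\{0,n-1\}$. For $S,T\subset V$, $C(S,T)$ denotes the set of edges with one endpoint in $S$ and the other in $T$. -}

module Defs where

open import Data.Nat using (ℕ; zero; suc; _+_; _∸_)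
open import Data.Nat.Properties using (_≟_)
open import Data.Fin using (Fin; toℕ)
open import Data.Bool using (Bool; true; false; _∧_; _∨_; not; if_then_else_)
open import Data.List using (List; length; filter; allFin; concatMap; map)
open import Data.Product using (_×_; _,_)
open import Relation.Nullary.Decidable using (⌊_⌋)
open import Relation.Binary.PropositionalEquality using (_≡_)
open import Function using (_∘_)

Vertex : ℕ → ℕ → Set
Vertex m n = Fin m × Fin n

_==_ : ℕ → ℕ → Bool
a == b = ⌊ a ≟ b ⌋

dist : ℕ → ℕ → ℕ
dist a b = (a ∸ b) + (b ∸ a)

wrapPair : ℕ → ℕ → ℕ → Bool
wrapPair M a b = ((a == 0) ∧ (b == (M ∸ 1))) ∨ ((b == 0) ∧ (a == (M ∸ 1)))

adjacent : (m n : ℕ) → Vertex m n → Vertex m n → Bool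
adjacent m n (i , j) (k , l) =
  let i' = toℕ i ; j' = toℕ j ; k' = toℕ k ; l' = toℕ l in
  not ((i' == k') ∧ (j' == l')) ∧
  ( ((dist i' k' + dist j' l') == 1)
  ∨ ((j' == l') ∧ wrapPair m i' k')
  ∨ ((i' == k') ∧ wrapPair n j' l') )

vertices : (m n : ℕ) → List (Vertex m n)
vertices m n = concatMap (λ i → map (λ j → (i , j)) (allFin n)) (allFin m)

VSubset : ℕ → ℕ → Set
VSubset m n = Vertex m n → Bool

card : {m n : ℕ} → VSubset m n → ℕ
card {m} {n} S = length (filter (λ v → S v Data.Bool.≟ true) (vertices m n))

-- |C(S, V∖S)|: the number of edges {u,v} with u ∈ S and v ∉ S.
-- Each such edge is counted exactly once as the ordered pair (u , v)
-- with u ∈ S, v ∉ S (the orientation is forced by S).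
cutSize : {m n : ℕ} → VSubset m n → ℕ
cutSize {m} {n} S =
  length (filter (λ p → (S (Data.Product.proj₁ p) ∧ not (S (Data.Product.proj₂ p))
                          ∧ adjacent m n (Data.Product.proj₁ p) (Data.Product.proj₂ p))
                          Data.Bool.≟ true)
    (concatMap (λ u → map (λ v → (u , v)) (vertices m n)) (vertices m n)))

module Submission where

-- Each row and each column of the torus is a cycle of length ≥ 3.  A line (row or column)
-- containing vertices both in and outside S is *mixed*; walking around it one must leave S
-- once and enter S once, which gives two distinct cut edges lying on that line.  A cut edge
-- lies on only one line, since two distinct lines share at most one vertex, so mixed lines
-- contribute disjoint sets of cut edges.  It therefore suffices to find three mixed lines:
-- if some row lies inside S, either some column does too (and the lines through two
-- vertices outside S do the job) or every column is mixed; if some row misses S, the same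
-- argument applies to the complement; otherwise every row is mixed.

open import Defs
open import Data.Nat using (ℕ; zero; suc; _+_; _*_; _∸_; _≤_; _<_; z≤n; s≤s; _<?_)
open import Data.Nat.Properties
  using (_≟_; +-comm; +-suc; *-suc; *-mono-≤; ≤-trans; ≤-reflexive; ≤-pred; <⇒≢; n≤1+n; 1+n≢n;
         m≢1+n+m; m≤n⇒m<n∨m≡n; n∸n≡0; m≤n⇒m∸n≡0; m+n∸n≡m; m+n∸m≡n; m∸[m∸n]≡n; ∸-monoʳ-≤;
         module ≤-Reasoning)
open import Data.Fin using (Fin; zero; suc; toℕ; fromℕ; fromℕ<; inject₁)
open import Data.Fin.Properties
  using (toℕ-fromℕ<; toℕ-fromℕ; toℕ-inject₁; toℕ-injective; toℕ<n; any?; all?; ¬∀⟶∃¬)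
  renaming (_≟_ to _≟F_)
open import Data.Fin.Induction using (<-weakInduction; >-weakInduction)
open import Data.Bool using (Bool; true; false; _∧_; not)
import Data.Bool as Bool
open import Data.Bool.Properties using (not-injective; ¬-not; ∨-comm; ∧-comm; ∨-zeroʳ)
open import Data.Product using (_×_; _,_; ∃; ∃₂; proj₁; proj₂)
open import Data.Sum using (_⊎_; inj₁; inj₂)
open import Data.Empty using (⊥-elim)
open import Data.List using (List; []; _∷_; length; filter; concatMap; map; _++_; allFin; cartesianProduct)
open import Data.List.Properties using (length-++; length-map; length-tabulate; length-removeAt′)
open import Data.List.Membership.Propositional using (_∈_)
open import Data.List.Membership.Propositional.Properties
  using (∈-filter⁻; ∈-filter⁺; ∈-cartesianProduct⁺; ∈-allFin)
open import Data.List.Relation.Unary.All using (All; []; _∷_)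
import Data.List.Relation.Unary.All as All
open import Data.List.Relation.Unary.All.Properties using (All¬⇒¬Any)
open import Data.List.Relation.Unary.Any using (Any; here; there)
import Data.List.Relation.Unary.Any as Any
open import Data.List.Relation.Unary.AllPairs using ([]; _∷_)
open import Data.List.Relation.Unary.Unique.Propositional using (Unique)
open import Data.List.Relation.Unary.Unique.Propositional.Properties using (filter⁺; cartesianProduct⁺; allFin⁺)
open import Relation.Nullary using (¬_; yes; no)
open import Relation.Nullary.Decidable using (_×-dec_)
open import Relation.Unary using () renaming (Decidable to Decidable₁)
open import Function using (_∘_; id)
open import Function.Definitions using (Injective)
open import Relation.Binary.PropositionalEquality

true≢false : true ≢ false
true≢false ()

==-refl : ∀ a → (a == a) ≡ true
==-refl a with a ≟ a
... | yes _ = refl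
... | no a≢a = ⊥-elim (a≢a refl)

==-false : ∀ {a b} → a ≢ b → (a == b) ≡ false
==-false {a} {b} a≢b with a ≟ b
... | yes a≡b = ⊥-elim (a≢b a≡b)
... | no _ = refl

==-sym : ∀ a b → (a == b) ≡ (b == a)
==-sym a b with a ≟ b
... | yes refl = sym (==-refl a)
... | no a≢b = sym (==-false (a≢b ∘ sym))

dist-sym : ∀ a b → dist a b ≡ dist b a
dist-sym a b = +-comm (a ∸ b) (b ∸ a)

dist-self : ∀ a → dist a a ≡ 0
dist-self a rewrite n∸n≡0 a = refl

dist-suc : ∀ a → dist a (suc a) ≡ 1
dist-suc a rewrite m≤n⇒m∸n≡0 (n≤1+n a) | m+n∸n≡m 1 a = refl

wrapPair-sym : ∀ M a b → wrapPair M a b ≡ wrapPair M b a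
wrapPair-sym M a b = ∨-comm ((a == 0) ∧ (b == (M ∸ 1))) ((b == 0) ∧ (a == (M ∸ 1)))

adjacent-sym : ∀ m n (u v : Vertex m n) → adjacent m n u v ≡ adjacent m n v u
adjacent-sym m n (i , j) (k , l)
  rewrite ==-sym (toℕ i) (toℕ k) | ==-sym (toℕ j) (toℕ l)
        | dist-sym (toℕ i) (toℕ k) | dist-sym (toℕ j) (toℕ l)
        | wrapPair-sym m (toℕ i) (toℕ k) | wrapPair-sym n (toℕ j) (toℕ l) = refl

-- Swapping the two coordinates is an isomorphism G_T(m,n) ≅ G_T(n,m): columns behave like rows.
adjacent-transpose : ∀ m n (i k : Fin m) (j l : Fin n) →
  adjacent m n (i , j) (k , l) ≡ adjacent n m (j , i) (l , k)
adjacent-transpose m n i k j l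
  rewrite ∧-comm (toℕ i == toℕ k) (toℕ j == toℕ l)
        | +-comm (dist (toℕ i) (toℕ k)) (dist (toℕ j) (toℕ l))
        | ∨-comm ((toℕ j == toℕ l) ∧ wrapPair m (toℕ i) (toℕ k))
                 ((toℕ i == toℕ k) ∧ wrapPair n (toℕ j) (toℕ l)) = refl

next : ∀ {n} → Fin n → Fin n
next {suc N} k with toℕ k <? N
... | yes k<N = fromℕ< (s≤s k<N)
... | no _ = zero

next-step : ∀ {N} (k : Fin (suc N)) → toℕ k < N → toℕ (next k) ≡ suc (toℕ k)
next-step {N} k k<N with toℕ k <? N
... | yes k<N′ = toℕ-fromℕ< (s≤s k<N′)
... | no k≮N = ⊥-elim (k≮N k<N)

next-wrap : ∀ {N} (k : Fin (suc N)) → toℕ k ≡ N → next k ≡ zero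
next-wrap {N} k k≡N with toℕ k <? N
... | yes k<N = ⊥-elim (<⇒≢ k<N k≡N)
... | no _ = refl

next-or-wrap : ∀ {N} (k : Fin (suc N)) → toℕ k < N ⊎ toℕ k ≡ N
next-or-wrap k = m≤n⇒m<n∨m≡n (≤-pred (toℕ<n k))

next-inject₁ : ∀ {N} (i : Fin N) → next (inject₁ i) ≡ suc i
next-inject₁ i = toℕ-injective (trans (next-step (inject₁ i) (subst (_< _) (sym (toℕ-inject₁ i)) (toℕ<n i)))
                                      (cong suc (toℕ-inject₁ i)))

next-last : ∀ N → next (fromℕ N) ≡ zero
next-last N = next-wrap (fromℕ N) (toℕ-fromℕ N)

-- On a cycle of length ≥ 3, two steps forward never return to the start; this is what
-- makes the edge leaving S differ from the (reversed) edge entering S.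
next²≢id : ∀ {N} → 2 ≤ N → (k : Fin (suc N)) → next (next k) ≢ k
next²≢id {N} 2≤N k k+2≡k with next-or-wrap k
... | inj₂ k≡N = <⇒≢ 2≤N (sym (trans (sym k≡N) (trans (sym (cong toℕ k+2≡k)) k+2≡1)))
  where
  k+2≡1 : toℕ (next (next k)) ≡ 1
  k+2≡1 rewrite next-wrap k k≡N = next-step zero (≤-trans (s≤s z≤n) 2≤N)
... | inj₁ k<N with next-or-wrap (next k)
...   | inj₁ k+1<N = m≢1+n+m (toℕ k) {1}
          (trans (sym (cong toℕ k+2≡k)) (trans (next-step (next k) k+1<N) (cong suc (next-step k k<N))))
...   | inj₂ k+1≡N = <⇒≢ 2≤N (sym (trans (sym k+1≡N) (trans (next-step k k<N) (cong suc k≡0))))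
  where
  k≡0 : toℕ k ≡ 0
  k≡0 = trans (sym (cong toℕ k+2≡k)) (cong toℕ (next-wrap (next k) k+1≡N))

-- A nonempty subset of Fin (suc N) closed under `next` is everything.  If it contains 0,
-- induct upwards; otherwise it misses the last element and, going downwards, everything.
closed-under-next : ∀ {N} (f : Fin (suc N) → Bool) → (∀ j → f j ≡ true → f (next j) ≡ true) →
  ∀ {a} → f a ≡ true → ∀ b → f b ≡ true
closed-under-next {N} f closed {a} fa with f zero in f0
... | true = <-weakInduction (λ i → f i ≡ true) f0 step
  where
  step : ∀ i → f (inject₁ i) ≡ true → f (suc i) ≡ true
  step i fi = subst (λ x → f x ≡ true) (next-inject₁ i) (closed (inject₁ i) fi)
... | false = ⊥-elim (true≢false (trans (sym fa) (all-false a)))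
  where
  back : ∀ j → f (next j) ≡ false → f j ≡ false
  back j fj+1 = ¬-not (λ fj → true≢false (trans (sym (closed j fj)) fj+1))
  all-false : ∀ i → f i ≡ false
  all-false = >-weakInduction (λ i → f i ≡ false)
    (back (fromℕ N) (subst (λ x → f x ≡ false) (sym (next-last N)) f0))
    (λ i fi+1 → back (inject₁ i) (subst (λ x → f x ≡ false) (sym (next-inject₁ i)) fi+1))

cycle-cut : ∀ {N} (f : Fin (suc N) → Bool) {a b : Fin (suc N)} → f a ≡ true → f b ≡ false →
  ∃ λ j → f j ≡ true × f (next j) ≡ false
cycle-cut {N} f {a} {b} fa fb with any? (λ j → (f j Bool.≟ true) ×-dec (f (next j) Bool.≟ false))
... | yes cut = cut
... | no no-cut = ⊥-elim (true≢false (trans (sym (closed-under-next f closed fa b)) fb))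
  where
  closed : ∀ j → f j ≡ true → f (next j) ≡ true
  closed j fj = ¬-not (λ fj+1 → no-cut (j , fj , fj+1))

adjacent-row-next : ∀ {m N} → 1 ≤ N → (i : Fin m) (j : Fin (suc N)) →
  adjacent m (suc N) (i , j) (i , next j) ≡ true
adjacent-row-next {m} {N} 1≤N i j with next-or-wrap j
... | inj₁ j<N rewrite next-step j j<N | ==-refl (toℕ i) | ==-false {toℕ j} {suc (toℕ j)} (1+n≢n ∘ sym)
                     | dist-self (toℕ i) | dist-suc (toℕ j) = refl
... | inj₂ j≡N rewrite next-wrap j j≡N | j≡N | ==-refl (toℕ i) | ==-false {N} {0} (<⇒≢ 1≤N ∘ sym)
                     | ==-refl N = ∨-zeroʳ _

adjacent-col-next : ∀ {M n} → 1 ≤ M → (i : Fin (suc M)) (j : Fin n) →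
  adjacent (suc M) n (i , j) (next i , j) ≡ true
adjacent-col-next {M} {n} 1≤M i j =
  trans (adjacent-transpose (suc M) n i (next i) j j) (adjacent-row-next 1≤M j i)

CutEdge : ∀ {m n} → VSubset m n → Vertex m n × Vertex m n → Set
CutEdge {m} {n} S (u , v) = S u ≡ true × S v ≡ false × adjacent m n u v ≡ true

-- An embedded cycle g of length ≥ 3 meeting S and its complement has two distinct cut
-- edges: one where the walk leaves S and one (reversed) where it re-enters S.
cycle-cuts : ∀ {m n N} → 2 ≤ N → (S : VSubset m n) (g : Fin (suc N) → Vertex m n) →
  Injective _≡_ _≡_ g → (∀ k → adjacent m n (g k) (g (next k)) ≡ true) →
  ∀ {a b} → S (g a) ≡ true → S (g b) ≡ false →
  ∃₂ λ j k → (g j , g (next j)) ≢ (g (next k) , g k) ×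
             CutEdge S (g j , g (next j)) × CutEdge S (g (next k) , g k)
cycle-cuts {m} {n} 2≤N S g g-inj adj ga∈S gb∉S
  with cycle-cut (S ∘ g) ga∈S gb∉S | cycle-cut (not ∘ S ∘ g) (cong not gb∉S) (cong not ga∈S)
... | j , gj∈S , gj+1∉S | k , gk∉S , gk+1∈S =
  j , k , distinct , (gj∈S , gj+1∉S , adj j) ,
  (not-injective gk+1∈S , not-injective gk∉S , trans (adjacent-sym m n (g (next k)) (g k)) (adj k))
  where
  distinct : (g j , g (next j)) ≢ (g (next k) , g k)
  distinct e = next²≢id 2≤N k (trans (cong next (sym (g-inj (cong proj₁ e)))) (g-inj (cong proj₂ e)))

data Line (m n : ℕ) : Set where
  row : Fin m → Line m n
  col : Fin n → Line m n

OnLine : ∀ {m n} → Line m n → Vertex m n → Set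
OnLine (row i) (i′ , _) = i′ ≡ i
OnLine (col j) (_ , j′) = j′ ≡ j

Mixed : ∀ {m n} → VSubset m n → Line m n → Set
Mixed S L = ∃₂ λ u v → OnLine L u × OnLine L v × S u ≡ true × S v ≡ false

CutOn : ∀ {m n} → VSubset m n → Line m n → Vertex m n × Vertex m n → Set
CutOn S L (u , v) = CutEdge S (u , v) × OnLine L u × OnLine L v

mixed-line-cuts : ∀ {m n} → 3 ≤ m → 3 ≤ n → (S : VSubset m n) (L : Line m n) → Mixed S L →
  ∃₂ λ p q → p ≢ q × CutOn S L p × CutOn S L q
mixed-line-cuts _ (s≤s 2≤N) S (row i) ((_ , j) , (_ , j′) , refl , refl , u∈S , v∉S)
  with cycle-cuts 2≤N S (i ,_) (cong proj₂) (adjacent-row-next (≤-trans (s≤s z≤n) 2≤N) i) u∈S v∉S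
... | _ , _ , p≢q , p-cut , q-cut = _ , _ , p≢q , (p-cut , refl , refl) , (q-cut , refl , refl)
mixed-line-cuts (s≤s 2≤M) _ S (col j) ((i , _) , (i′ , _) , refl , refl , u∈S , v∉S)
  with cycle-cuts 2≤M S (_, j) (cong proj₁) (λ k → adjacent-col-next (≤-trans (s≤s z≤n) 2≤M) k j) u∈S v∉S
... | _ , _ , p≢q , p-cut , q-cut = _ , _ , p≢q , (p-cut , refl , refl) , (q-cut , refl , refl)

lines-meet-once : ∀ {m n} {L L′ : Line m n} {u v : Vertex m n} → L ≢ L′ →
  OnLine L u → OnLine L′ u → OnLine L v → OnLine L′ v → u ≡ v
lines-meet-once {L = row i} {row i′} L≢L′ ui ui′ _ _ = ⊥-elim (L≢L′ (cong row (trans (sym ui) ui′)))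
lines-meet-once {L = col j} {col j′} L≢L′ uj uj′ _ _ = ⊥-elim (L≢L′ (cong col (trans (sym uj) uj′)))
lines-meet-once {L = row i} {col j} _ ui uj vi vj = cong₂ _,_ (trans ui (sym vi)) (trans uj (sym vj))
lines-meet-once {L = col j} {row i} _ uj ui vj vi = cong₂ _,_ (trans ui (sym vi)) (trans uj (sym vj))

cut-on-one-line : ∀ {m n} (S : VSubset m n) {L L′ : Line m n} {p} → L ≢ L′ → CutOn S L p → ¬ CutOn S L′ p
cut-on-one-line S L≢L′ ((u∈S , v∉S , _) , uL , vL) (_ , uL′ , vL′) =
  true≢false (trans (sym u∈S) (trans (cong S (lines-meet-once L≢L′ uL uL′ vL vL′)) v∉S))

cuts-on-lines : ∀ {m n} → 3 ≤ m → 3 ≤ n → (S : VSubset m n) (Ls : List (Line m n)) →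
  Unique Ls → All (Mixed S) Ls →
  ∃ λ ps → Unique ps × All (λ p → Any (λ L → CutOn S L p) Ls) ps × 2 * length Ls ≤ length ps
cuts-on-lines _ _ S [] [] [] = [] , [] , [] , z≤n
cuts-on-lines 3≤m 3≤n S (L ∷ Ls) (L∉Ls ∷ Ls-unique) (L-mixed ∷ Ls-mixed)
  with mixed-line-cuts 3≤m 3≤n S L L-mixed | cuts-on-lines 3≤m 3≤n S Ls Ls-unique Ls-mixed
... | p , q , p≢q , p-cut , q-cut | ps , ps-unique , ps-cut , 2|Ls|≤|ps| =
  p ∷ q ∷ ps , (p≢q ∷ fresh p-cut) ∷ fresh q-cut ∷ ps-unique ,
  here p-cut ∷ here q-cut ∷ All.map there ps-cut ,
  ≤-trans (≤-reflexive (*-suc 2 (length Ls))) (s≤s (s≤s 2|Ls|≤|ps|))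
  where
  -- a cut edge on L lies on none of the lines Ls, so it is new
  fresh : ∀ {r} → CutOn S L r → All (r ≢_) ps
  fresh r-cut = All.map (λ r′-cut r≡r′ →
    All¬⇒¬Any (All.map (λ L≢L′ → cut-on-one-line S L≢L′ r-cut) L∉Ls) (subst _ (sym r≡r′) r′-cut)) ps-cut

ThreeMixedLines : ∀ {m n} → VSubset m n → Set
ThreeMixedLines {m} {n} S = ∃ λ (Ls : List (Line m n)) → length Ls ≡ 3 × Unique Ls × All (Mixed S) Ls

three-lines : ∀ {m n} {S : VSubset m n} {L₁ L₂ L₃ : Line m n} → L₁ ≢ L₂ → L₁ ≢ L₃ → L₂ ≢ L₃ →
  Mixed S L₁ → Mixed S L₂ → Mixed S L₃ → ThreeMixedLines S
three-lines L₁≢L₂ L₁≢L₃ L₂≢L₃ x₁ x₂ x₃ =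
  _ , refl , (L₁≢L₂ ∷ L₁≢L₃ ∷ []) ∷ (L₂≢L₃ ∷ []) ∷ [] ∷ [] , x₁ ∷ x₂ ∷ x₃ ∷ []

mixed-complement : ∀ {m n} (S : VSubset m n) {L} → Mixed (not ∘ S) L → Mixed S L
mixed-complement S (u , v , uL , vL , u∉S , v∈S) = v , u , vL , uL , not-injective v∈S , not-injective u∉S

-- S contains row i* and column j*; for c ≠ d outside S, take the rows through c and d and
-- the column through c, or, if c and d share a row, the columns through c and d and that row.
full-row-and-column : ∀ {m n} (S : VSubset m n) (i* : Fin m) (j* : Fin n) →
  (∀ j → S (i* , j) ≡ true) → (∀ i → S (i , j*) ≡ true) →
  ∀ {c d} → c ≢ d → S c ≡ false → S d ≡ false → ThreeMixedLines S
full-row-and-column S i* j* row⊆S col⊆S {ci , cj} {di , dj} c≢d c∉S d∉S with ci ≟F di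
... | no ci≢di =
  three-lines {L₁ = row ci} {row di} {col cj} (λ { refl → ci≢di refl }) (λ ()) (λ ())
    ((ci , j*) , (ci , cj) , refl , refl , col⊆S ci , c∉S)
    ((di , j*) , (di , dj) , refl , refl , col⊆S di , d∉S)
    ((i* , cj) , (ci , cj) , refl , refl , row⊆S cj , c∉S)
... | yes refl =
  three-lines {L₁ = col cj} {col dj} {row ci} (λ { refl → c≢d refl }) (λ ()) (λ ())
    ((i* , cj) , (ci , cj) , refl , refl , row⊆S cj , c∉S)
    ((i* , dj) , (ci , dj) , refl , refl , row⊆S dj , d∉S)
    ((ci , j*) , (ci , cj) , refl , refl , col⊆S ci , c∉S)

-- S contains row i*: either some column is also inside S, or every column meets row i* in
-- S and leaves S somewhere, so the first three columns are mixed.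
full-row : ∀ {m n} → 3 ≤ n → (S : VSubset m n) (i* : Fin m) → (∀ j → S (i* , j) ≡ true) →
  ∀ {c d} → c ≢ d → S c ≡ false → S d ≡ false → ThreeMixedLines S
full-row {m} (s≤s (s≤s (s≤s _))) S i* row⊆S c≢d c∉S d∉S
  with any? (λ j → all? (λ i → S (i , j) Bool.≟ true))
... | yes (j* , col⊆S) = full-row-and-column S i* j* row⊆S col⊆S c≢d c∉S d∉S
... | no no-full-column =
  three-lines {L₁ = col zero} {col (suc zero)} {col (suc (suc zero))} (λ ()) (λ ()) (λ ())
    (column-mixed _) (column-mixed _) (column-mixed _)
  where
  column-mixed : ∀ j → Mixed S (col j)
  column-mixed j with ¬∀⟶∃¬ m (λ i → S (i , j) ≡ true) (λ i → S (i , j) Bool.≟ true) (no-full-column ∘ (j ,_))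
  ... | i , i∉S = (i* , j) , (i , j) , refl , refl , row⊆S j , ¬-not i∉S

three-mixed-lines : ∀ {m n} → 3 ≤ m → 3 ≤ n → (S : VSubset m n) →
  ∀ {a b} → a ≢ b → S a ≡ true → S b ≡ true →
  ∀ {c d} → c ≢ d → S c ≡ false → S d ≡ false → ThreeMixedLines S
three-mixed-lines {n = n} (s≤s (s≤s (s≤s _))) 3≤n S a≢b a∈S b∈S c≢d c∉S d∉S
  with any? (λ i → all? (λ j → S (i , j) Bool.≟ true)) | any? (λ i → all? (λ j → S (i , j) Bool.≟ false))
... | yes (i* , row⊆S) | _ = full-row 3≤n S i* row⊆S c≢d c∉S d∉S
... | no _ | yes (i* , row∩S≡∅) =
  let Ls , |Ls|≡3 , Ls-unique , Ls-mixed =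
        full-row 3≤n (not ∘ S) i* (cong not ∘ row∩S≡∅) a≢b (cong not a∈S) (cong not b∈S)
  in Ls , |Ls|≡3 , Ls-unique , All.map (mixed-complement S) Ls-mixed
... | no no-full-row | no no-empty-row =
  three-lines {L₁ = row zero} {row (suc zero)} {row (suc (suc zero))} (λ ()) (λ ()) (λ ())
    (row-mixed _) (row-mixed _) (row-mixed _)
  where
  row-mixed : ∀ i → Mixed S (row i)
  row-mixed i with ¬∀⟶∃¬ n (λ j → S (i , j) ≡ true) (λ j → S (i , j) Bool.≟ true) (no-full-row ∘ (i ,_))
                 | ¬∀⟶∃¬ n (λ j → S (i , j) ≡ false) (λ j → S (i , j) Bool.≟ false) (no-empty-row ∘ (i ,_))
  ... | j , j∉S | j′ , j′∈S = (i , j′) , (i , j) , refl , refl , ¬-not j′∈S , ¬-not j∉S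

∈-─ : ∀ {A : Set} {x z : A} {ys : List A} (x∈ys : x ∈ ys) → z ∈ ys → z ≢ x → z ∈ (ys Any.─ x∈ys)
∈-─ (here refl) (here refl) z≢x = ⊥-elim (z≢x refl)
∈-─ (here refl) (there z∈ys) _ = z∈ys
∈-─ (there _) (here refl) _ = here refl
∈-─ (there x∈ys) (there z∈ys) z≢x = there (∈-─ x∈ys z∈ys z≢x)

unique-⊆-length : ∀ {A : Set} {xs ys : List A} → Unique xs → All (_∈ ys) xs → length xs ≤ length ys
unique-⊆-length [] [] = z≤n
unique-⊆-length {ys = ys} (x∉xs ∷ xs-unique) (x∈ys ∷ xs⊆ys) =
  subst (_ ≤_) (sym (length-removeAt′ ys (Any.index x∈ys)))
    (s≤s (unique-⊆-length xs-unique
      (All.zipWith (λ (z∈ys , x≢z) → ∈-─ x∈ys z∈ys (x≢z ∘ sym)) (xs⊆ys , x∉xs))))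

two-members : ∀ {A : Set} {P : A → Set} (P? : Decidable₁ P) {xs : List A} → Unique xs →
  2 ≤ length (filter P? xs) → ∃₂ λ a b → a ≢ b × P a × P b
two-members {P = P} P? {xs} xs-unique 2≤|Pxs| with filter P? xs in eq | filter⁺ P? xs-unique
... | a ∷ b ∷ _ | (a≢b ∷ _) ∷ _ = a , b , a≢b , member (here refl) , member (there (here refl))
  where
  member : ∀ {z} → z ∈ a ∷ b ∷ _ → P z
  member z∈ = proj₂ (∈-filter⁻ P? {xs = xs} (subst (_ ∈_) (sym eq) z∈))
... | [] | _ with () ← 2≤|Pxs|
... | _ ∷ [] | _ with s≤s () ← 2≤|Pxs|

-- Defs lists pairs via concatMap; the library's lemmas are about cartesianProduct.
concatMap-pairs : ∀ {A B : Set} (xs : List A) (ys : List B) →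
  concatMap (λ x → map (λ y → (x , y)) ys) xs ≡ cartesianProduct xs ys
concatMap-pairs [] ys = refl
concatMap-pairs (x ∷ xs) ys = cong (map (x ,_) ys ++_) (concatMap-pairs xs ys)

length-cartesianProduct : ∀ {A B : Set} (xs : List A) (ys : List B) →
  length (cartesianProduct xs ys) ≡ length xs * length ys
length-cartesianProduct [] ys = refl
length-cartesianProduct (x ∷ xs) ys = begin
  length (map (x ,_) ys ++ cartesianProduct xs ys)         ≡⟨ length-++ (map (x ,_) ys) ⟩
  length (map (x ,_) ys) + length (cartesianProduct xs ys) ≡⟨ cong₂ _+_ (length-map (x ,_) ys)
                                                                      (length-cartesianProduct xs ys) ⟩
  length ys + length xs * length ys                        ∎
  where open ≡-Reasoning

vertices-unique : ∀ m n → Unique (vertices m n)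
vertices-unique m n rewrite concatMap-pairs (allFin m) (allFin n) = cartesianProduct⁺ (allFin⁺ m) (allFin⁺ n)

∈-vertices : ∀ {m n} (v : Vertex m n) → v ∈ vertices m n
∈-vertices {m} {n} (i , j) rewrite concatMap-pairs (allFin m) (allFin n) =
  ∈-cartesianProduct⁺ (∈-allFin i) (∈-allFin j)

length-vertices : ∀ m n → length (vertices m n) ≡ m * n
length-vertices m n rewrite concatMap-pairs (allFin m) (allFin n)
  | length-cartesianProduct (allFin m) (allFin n) | length-tabulate {n = m} id | length-tabulate {n = n} id = refl

filter-complement : ∀ {A : Set} (f : A → Bool) (xs : List A) →
  length (filter (λ x → f x Bool.≟ true) xs) + length (filter (λ x → not (f x) Bool.≟ true) xs) ≡ length xs
filter-complement f [] = refl
filter-complement f (x ∷ xs) with f x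
... | true = cong suc (filter-complement f xs)
... | false = trans (+-suc _ _) (cong suc (filter-complement f xs))

card-complement : ∀ {m n} (S : VSubset m n) → card S + card (not ∘ S) ≡ m * n
card-complement {m} {n} S = trans (filter-complement S (vertices m n)) (length-vertices m n)

complement-has-two : ∀ {m n} (S : VSubset m n) → 2 ≤ m * n → card S ≤ m * n ∸ 2 → 2 ≤ card (not ∘ S)
complement-has-two {m} {n} S 2≤mn |S|≤mn-2 = begin
  2                                ≡⟨ m∸[m∸n]≡n 2≤mn ⟨
  m * n ∸ (m * n ∸ 2)              ≤⟨ ∸-monoʳ-≤ (m * n) |S|≤mn-2 ⟩
  m * n ∸ card S                   ≡⟨ cong (_∸ card S) (card-complement S) ⟨
  card S + card (not ∘ S) ∸ card S ≡⟨ m+n∸m≡n (card S) _ ⟩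
  card (not ∘ S)                   ∎
  where open ≤-Reasoning

cut-list : ∀ {m n} → VSubset m n → List (Vertex m n × Vertex m n)
cut-list {m} {n} S =
  filter (λ p → (S (proj₁ p) ∧ not (S (proj₂ p)) ∧ adjacent m n (proj₁ p) (proj₂ p)) Bool.≟ true)
    (concatMap (λ u → map (λ v → (u , v)) (vertices m n)) (vertices m n))

cut-edge-listed : ∀ {m n} (S : VSubset m n) {p} → CutEdge S p → p ∈ cut-list S
cut-edge-listed {m} {n} S {u , v} (u∈S , v∉S , u~v) =
  ∈-filter⁺ _ (subst ((u , v) ∈_) (sym (concatMap-pairs (vertices m n) (vertices m n)))
                (∈-cartesianProduct⁺ (∈-vertices u) (∈-vertices v)))
              is-cut
  where
  is-cut : (S u ∧ not (S v) ∧ adjacent m n u v) ≡ true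
  is-cut rewrite u∈S | v∉S | u~v = refl

cut-edges-bound : ∀ {m n} (S : VSubset m n) {ps} → Unique ps → All (CutEdge S) ps → length ps ≤ cutSize S
cut-edges-bound S ps-unique ps-cut = unique-⊆-length ps-unique (All.map (cut-edge-listed S) ps-cut)

lemma2p1 : (m n : ℕ) → 3 ≤ m → 3 ≤ n → (S : VSubset m n) →
    2 ≤ card S → card S ≤ m * n ∸ 2 → 6 ≤ cutSize S
lemma2p1 m n 3≤m 3≤n S 2≤|S| |S|≤mn-2
  with two-members _ (vertices-unique m n) 2≤|S|
     | two-members _ (vertices-unique m n)
         (complement-has-two S (≤-trans (s≤s (s≤s z≤n)) (*-mono-≤ 3≤m 3≤n)) |S|≤mn-2)
... | a , b , a≢b , a∈S , b∈S | c , d , c≢d , c∉S , d∉S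
  with three-mixed-lines 3≤m 3≤n S a≢b a∈S b∈S c≢d (not-injective c∉S) (not-injective d∉S)
... | Ls , |Ls|≡3 , Ls-unique , Ls-mixed
  with cuts-on-lines 3≤m 3≤n S Ls Ls-unique Ls-mixed
... | ps , ps-unique , ps-on-lines , 2|Ls|≤|ps| = begin
  6             ≡⟨ cong (2 *_) |Ls|≡3 ⟨
  2 * length Ls ≤⟨ 2|Ls|≤|ps| ⟩
  length ps     ≤⟨ cut-edges-bound S ps-unique (All.map cut-edge ps-on-lines) ⟩
  cutSize S     ∎
  where
  open ≤-Reasoning
  cut-edge : ∀ {p} → Any (λ L → CutOn S L p) Ls → CutEdge S p
  cut-edge = proj₁ ∘ proj₂ ∘ Any.satisfied
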